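{- For any function $f:\{0,1\}^n\times\{0,1\}^n\to\{0,1\}$ with $m(f)=k$ and any $0\le a,b\le n$, the number of jumps in $h_{a,b}$, i.e. $|\mathcal{J}(h_{a,b})|$, is at most $2^{O(k)}\log n$ (absolute constants).
   Context: $|\cdot|$ is Hamming weight, $\Delta$ Hamming distance, $[n]=\{1,\dots,n\}$; $f$ is assumed permutation-invariant, i.e. $f(\mathbf{x}^\pi,\mathbf{y}^\pi)=f(\mathbf{x},\mathbf{y})$ for every bijection $\pi$ of $[n]$ with $x^\pi_i=x_{\pi(i)}$. $h_{a,b}(d)=f(\mathbf{x},\mathbf{y})$ for any $\mathbf{x},\mathbf{y}$ with $|\mathbf{x}|=a,|\mathbf{y}|=b,\Delta(\mathbf{x},\mathbf{y})=d$ if such exist, and $?$ otherwise. $\mathcal{J}(h_{a,b})=\{(c,g): h_{a,b}(c\pm g)\in\{0,1\},\ h_{a,b}(c-g)\ne h_{a,b}(c+g),\ h_{a,b}(i)=?\ \forall\, c-g<i<c+g\}$. $m(f)=\frac1C\max_{a,b\in[n],(c,g)\in\mathcal{J}(h_{a,b})}\max\{\min\{a,b,c,n-a,n-b,n-c\}/g,\ \log(\min\{c,n-c\}/g)\}$ for a suitably large absolute constant $C$. -}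

module Defs where

open import Data.Bool using (Bool; true; false; _∧_; _∨_; not; _xor_; if_then_else_)
open import Data.Nat using (ℕ; zero; suc; _+_; _*_; _∸_; _≡ᵇ_; _<ᵇ_; _⊔_; _⊓_; _/_)
open import Data.Nat.Logarithm using (⌊log₂_⌋)
open import Data.List using (List; []; _∷_; map; concatMap; filterᵇ; head; length; upTo; foldr)
open import Data.Maybe using (Maybe; just; nothing)
open import Data.Product using (_×_; _,_)
open import Data.Vec using (Vec; []; _∷_; zipWith; tabulate; lookup)
open import Data.Fin.Permutation using (Permutation′; _⟨$⟩ʳ_)
open import Relation.Binary.PropositionalEquality using (_≡_)

allVecs : (n : ℕ) → List (Vec Bool n)
allVecs zero = [] ∷ []
allVecs (suc n) = concatMap (λ v → (false ∷ v) ∷ (true ∷ v) ∷ []) (allVecs n)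

weight : ∀ {n} → Vec Bool n → ℕ
weight [] = 0
weight (b ∷ v) = (if b then 1 else 0) + weight v

dist : ∀ {n} → Vec Bool n → Vec Bool n → ℕ
dist x y = weight (zipWith _xor_ x y)

permute : ∀ {n} → Permutation′ n → Vec Bool n → Vec Bool n
permute π x = tabulate (λ i → lookup x (π ⟨$⟩ʳ i))

PermInvariant : ∀ {n} → (Vec Bool n → Vec Bool n → Bool) → Set
PermInvariant {n} f =
  ∀ (π : Permutation′ n) (x y : Vec Bool n) → f (permute π x) (permute π y) ≡ f x y

-- h_{a,b}(d): value f(x,y) on some (the first in enumeration order) x,y with
-- |x| = a, |y| = b, Δ(x,y) = d; `nothing` plays the role of `?`.
-- For permutation-invariant f the choice of x,y is irrelevant.
h : ∀ {n} → (Vec Bool n → Vec Bool n → Bool) → ℕ → ℕ → ℕ → Maybe Bool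
h {n} f a b d =
  head (concatMap (λ x → map (λ y → f x y)
         (filterᵇ (λ y → (weight x ≡ᵇ a) ∧ (weight y ≡ᵇ b) ∧ (dist x y ≡ᵇ d)) (allVecs n)))
       (allVecs n))

isDefined : Maybe Bool → Bool
isDefined (just _) = true
isDefined nothing = false

differ : Maybe Bool → Maybe Bool → Bool
differ (just u) (just v) = u xor v
differ _ _ = false

allᵇ : ∀ {A : Set} → (A → Bool) → List A → Bool
allᵇ p [] = true
allᵇ p (x ∷ xs) = p x ∧ allᵇ p xs

-- A jump (c,g) ∈ J(h_{a,b}) with g > 0 is represented by its endpoints
-- lo = c - g, hi = c + g (so c = (lo+hi)/2, g = (hi-lo)/2).
isJump : ∀ {n} → (Vec Bool n → Vec Bool n → Bool) → ℕ → ℕ → ℕ → ℕ → Bool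
isJump f a b lo hi =
  (lo <ᵇ hi) ∧ differ (h f a b lo) (h f a b hi)
  ∧ allᵇ (λ i → not ((lo <ᵇ i) ∧ (i <ᵇ hi)) ∨ not (isDefined (h f a b i))) (upTo hi)

jumps : ∀ {n} → (Vec Bool n → Vec Bool n → Bool) → ℕ → ℕ → List (ℕ × ℕ)
jumps {n} f a b =
  concatMap (λ lo → map (λ hi → (lo , hi))
      (filterᵇ (λ hi → isJump f a b lo hi) (upTo (suc n))))
    (upTo (suc n))

numJumps : ∀ {n} → (Vec Bool n → Vec Bool n → Bool) → ℕ → ℕ → ℕ
numJumps f a b = length (jumps f a b)

-- division that is 0 for divisor 0 (only used with positive divisors)
_div_ : ℕ → ℕ → ℕ
x div zero = 0
x div (suc k) = x / suc k

-- integer version of the jump measure for a single jump (lo,hi) of h_{a,b}: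
--   max{ ⌊ min{a,b,c,n-a,n-b,n-c}/g ⌋ , ⌊ log₂ ⌊ min{c,n-c}/g ⌋ ⌋ },
-- computed with doubled quantities 2c = lo+hi, 2g = hi-lo.
jumpMeasure : ℕ → ℕ → ℕ → ℕ → ℕ → ℕ
jumpMeasure n a b lo hi =
  let g2 = hi ∸ lo
      q2 = (2 * a) ⊓ (2 * b) ⊓ (lo + hi) ⊓ (2 * n ∸ 2 * a) ⊓ (2 * n ∸ 2 * b) ⊓ (2 * n ∸ (lo + hi))
      s2 = (lo + hi) ⊓ (2 * n ∸ (lo + hi))
  in (q2 div g2) ⊔ ⌊log₂ (s2 div g2) ⌋

maxList : List ℕ → ℕ
maxList = foldr _⊔_ 0

-- integer version of C·m(f): maximum over a,b ∈ [n] and jumps of h_{a,b}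
-- (0 if there are no jumps at all)
mNat : ∀ {n} → (Vec Bool n → Vec Bool n → Bool) → ℕ
mNat {n} f =
  maxList (concatMap (λ a → concatMap (λ b →
      map (λ { (lo , hi) → jumpMeasure n a b lo hi }) (jumps f a b))
    (map suc (upTo n))) (map suc (upTo n)))

module Submission where

-- Write M = mNat f and K = 2^(M+1).  A jump (lo , hi) of h_{a,b} has measure at
-- most M, and its logarithmic term alone gives  min(lo+hi, 2n−lo−hi) < K·(hi−lo):
-- the jump is "wide" compared with its distance from 0 or from n.  Distinct
-- jumps are disjoint, and the list J(h_{a,b}) runs from left to right.  The core
-- counting fact (ChainCount) is that in a left-to-right chain of intervals that
-- are wide at 0, the lower end doubles after every K intervals, so inside [0, n]
-- with n < 2^t there are at most 1 + (t+1)K of them.  The reflection d ↦ n − d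
-- turns jumps wide at n into such a chain (two-sided-count).  With t = ⌊log₂ n⌋+1
-- this gives at most 2(1 + (⌊log₂ n⌋+2)K) jumps, which is ≤ 14·2^M·⌊log₂ n⌋ when
-- n ≥ 2.  The cases a = 0, b = 0 and n = 1 (not covered by m(f)) have no jumps,
-- because h_{a,b} is defined at a single distance.

open import Defs
open import Data.Bool using (Bool; true; false; _∧_; _∨_; not; T; T?; if_then_else_)
open import Data.Bool.Properties using (T-∧; xor-identityʳ)
open import Data.Nat
open import Data.Nat.Properties
open import Data.Nat.Tactic.RingSolver using (solve-∀)
open import Data.Nat.DivMod using (m*n/n≡m; /-monoˡ-≤)
open import Data.Nat.Logarithm using (⌊log₂_⌋; ⌊log₂⌋-mono-≤; ⌊log₂[2^n]⌋≡n)
open import Data.List using (List; []; _∷_; length; map; filter; filterᵇ; upTo; reverse; head)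
open import Data.List.Properties using (length-map; length-reverse; unfold-reverse)
open import Data.List.Relation.Unary.All as All using (All; []; _∷_)
import Data.List.Relation.Unary.All.Properties as All
open import Data.List.Relation.Unary.AllPairs as AllPairs using (AllPairs; []; _∷_)
import Data.List.Relation.Unary.AllPairs.Properties as AllPairs
open import Data.Product using (Σ; ∃; _×_; _,_; proj₁; proj₂)
open import Data.Product.Relation.Binary.Lex.Strict using (×-Lex)
open import Data.List.Membership.Propositional using (_∈_; find; lose)
open import Data.List.Membership.Propositional.Properties using (∈-concatMap⁺; ∈-concatMap⁻; ∈-map⁺; ∈-map⁻; ∈-filter⁻; ∈-upTo⁺; ∈-upTo⁻)
open import Data.List.Relation.Unary.Any using (here; there)
open import Data.Maybe using (Maybe; just; nothing)
open import Data.Sum using (_⊎_; inj₁; inj₂; [_,_]′; map₂)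
open import Data.Empty using (⊥-elim)
open import Data.Vec using (Vec; []; _∷_)
open import Function using (_∘_; flip; Equivalence)
open import Relation.Binary.PropositionalEquality
open import Relation.Nullary using (yes; no; does; ¬_)
open import Relation.Unary using (Decidable)
open import Relation.Unary.Properties using (∁?)

Interval : Set
Interval = ℕ × ℕ

Precedes : Interval → Interval → Set
Precedes (_ , hi) (lo′ , _) = hi ≤ lo′

Within : ℕ → Interval → Set
Within n (_ , hi) = hi ≤ n

-- i is wide compared with its distance from 0: lo + hi < K · (hi − lo),
-- i.e. its midpoint is less than K/2 times its length away from 0
Wide : ℕ → Interval → Set
Wide K (lo , hi) = lo + hi < K * (hi ∸ lo)

wide⇒lo<hi : ∀ {K lo hi} → Wide K (lo , hi) → lo < hi
wide⇒lo<hi {K} {lo} {hi} wide with lo <? hi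
... | yes lo<hi = lo<hi
... | no lo≮hi = ⊥-elim (n≮0 (begin-strict
  lo + hi         <⟨ wide ⟩
  K * (hi ∸ lo)   ≡⟨ cong (K *_) (m≤n⇒m∸n≡0 (≮⇒≥ lo≮hi)) ⟩
  K * 0           ≡⟨ *-zeroʳ K ⟩
  0               ∎))
  where open ≤-Reasoning

wide-gain : ∀ {K m lo hi} → m ≤ lo → Wide K (lo , hi) → suc (2 * m) + K * lo ≤ K * hi
wide-gain {K} {m} {lo} {hi} m≤lo wide = begin
  suc (2 * m) + K * lo      ≤⟨ +-monoˡ-≤ (K * lo) (≤-trans (s≤s 2m≤lo+hi) wide) ⟩
  K * (hi ∸ lo) + K * lo    ≡⟨ sym (*-distribˡ-+ K (hi ∸ lo) lo) ⟩
  K * ((hi ∸ lo) + lo)      ≡⟨ cong (K *_) (m∸n+n≡m lo≤hi) ⟩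
  K * hi                    ∎
  where
  open ≤-Reasoning
  lo≤hi : lo ≤ hi
  lo≤hi = <⇒≤ (wide⇒lo<hi {K} wide)
  2m≤lo+hi : 2 * m ≤ lo + hi
  2m≤lo+hi = +-mono-≤ m≤lo (≤-trans (≤-reflexive (+-identityʳ m)) (≤-trans m≤lo lo≤hi))

-- Reading the chain from the left, after every K intervals the lower end has
-- at least doubled, so only about K · log₂ n intervals fit.
module ChainCount (K n : ℕ) .{{_ : NonZero K}} where

  0<K : 0 < K
  0<K = >-nonZero⁻¹ K

  -- i begins past m by at least j steps of (2m+1)/K
  Beyond : ℕ → ℕ → Interval → Set
  Beyond m j (lo , _) = j * suc (2 * m) + K * m ≤ K * lo

  beyond⇒≥ : ∀ {m j i} → Beyond m j i → m ≤ proj₁ i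
  beyond⇒≥ {m} {j} β = *-cancelˡ-≤ K (≤-trans (m≤n+m (K * m) (j * suc (2 * m))) β)

  beyond-next : ∀ {m j i xs} → Beyond m j i → Wide K i → All (Precedes i) xs →
                All (Beyond m (suc j)) xs
  beyond-next {m} {j} {lo , hi} β wide = All.map λ {(lo′ , _)} hi≤lo′ → begin
    (s + j * s) + K * m     ≡⟨ +-assoc s (j * s) (K * m) ⟩
    s + (j * s + K * m)     ≤⟨ +-monoʳ-≤ s β ⟩
    s + K * lo              ≤⟨ wide-gain {K} (beyond⇒≥ {m} {j} {lo , hi} β) wide ⟩
    K * hi                  ≤⟨ *-monoʳ-≤ K hi≤lo′ ⟩
    K * lo′                 ∎
    where
    open ≤-Reasoning
    s : ℕ
    s = suc (2 * m)

  beyond-double : ∀ {m j i} → suc j ≡ K → Beyond m (suc j) i → Beyond (2 * m) 0 i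
  beyond-double {m} {j} {lo , _} sj≡K β = *-monoʳ-≤ K (begin
    2 * m                ≤⟨ ≤-trans (n≤1+n (2 * m)) (m≤m+n s m) ⟩
    s + m                ≤⟨ *-cancelˡ-≤ K (subst (_≤ K * lo) K-steps β) ⟩
    lo                   ∎)
    where
    open ≤-Reasoning
    s : ℕ
    s = suc (2 * m)
    K-steps : suc j * s + K * m ≡ K * (s + m)
    K-steps = trans (cong (λ c → c * s + K * m) sj≡K) (sym (*-distribˡ-+ K s m))

  2ᵗ⁺¹m≡2ᵗ[2m] : ∀ t m → 2 ^ suc t * m ≡ 2 ^ t * (2 * m)
  2ᵗ⁺¹m≡2ᵗ[2m] t m = trans (cong (_* m) (*-comm 2 (2 ^ t))) (*-assoc (2 ^ t) 2 m)

  -- main induction along the chain: t counts the doublings of m still possible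
  -- below n, j the steps already made towards the next doubling
  count : ∀ t m j xs → 1 ≤ m → j < K → n < 2 ^ t * m →
          AllPairs Precedes xs → All (Wide K) xs → All (Within n) xs → All (Beyond m j) xs →
          j + length xs ≤ suc t * K
  count t m j [] _ j<K _ _ _ _ _ =
    ≤-trans (≤-reflexive (+-identityʳ j)) (≤-trans (<⇒≤ j<K) (m≤m+n K (t * K)))
  count zero m j (i ∷ _) _ _ n<m _ (wide ∷ _) (hi≤n ∷ _) (β ∷ _) =
    ⊥-elim (<⇒≱ n<m (begin
      m + 0        ≡⟨ +-identityʳ m ⟩
      m            ≤⟨ beyond⇒≥ {m} {j} {i} β ⟩
      proj₁ i      ≤⟨ <⇒≤ (wide⇒lo<hi {K} wide) ⟩
      proj₂ i      ≤⟨ hi≤n ⟩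
      n            ∎))
    where open ≤-Reasoning
  count (suc t) m j (i ∷ xs) 1≤m j<K n<2ᵗm (i≺xs ∷ chain) (wide ∷ wides) (_ ∷ within) (β ∷ _)
    with suc j <? K
  ... | yes sj<K = begin
    j + suc (length xs)   ≡⟨ +-suc j (length xs) ⟩
    suc j + length xs     ≤⟨ count (suc t) m (suc j) xs 1≤m sj<K n<2ᵗm chain wides within next ⟩
    suc (suc t) * K       ∎
    where
    open ≤-Reasoning
    next : All (Beyond m (suc j)) xs
    next = beyond-next {m} {j} β wide i≺xs
  ... | no sj≮K = begin
    j + suc (length xs)   ≡⟨ +-suc j (length xs) ⟩
    suc j + length xs     ≡⟨ cong (_+ length xs) sj≡K ⟩
    K + length xs         ≤⟨ +-monoʳ-≤ K (count t (2 * m) 0 xs 1≤2m 0<K n<2ᵗ2m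
                               chain wides within (All.map (λ {i′} → beyond-double {m} {j} {i′} sj≡K) next)) ⟩
    K + suc t * K         ∎
    where
    open ≤-Reasoning
    next : All (Beyond m (suc j)) xs
    next = beyond-next {m} {j} β wide i≺xs
    sj≡K : suc j ≡ K
    sj≡K = ≤-antisym j<K (≮⇒≥ sj≮K)
    1≤2m : 1 ≤ 2 * m
    1≤2m = ≤-trans 1≤m (m≤m+n m (m + 0))
    n<2ᵗ2m : n < 2 ^ t * (2 * m)
    n<2ᵗ2m = subst (n <_) (2ᵗ⁺¹m≡2ᵗ[2m] t m) n<2ᵗm

  -- a chain of wide intervals in [0, n] with n < 2^t has at most 1 + (t+1)K members
  -- (all but the first start at a positive point)
  chain-length : ∀ t xs → n < 2 ^ t → AllPairs Precedes xs → All (Wide K) xs → All (Within n) xs →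
                 length xs ≤ suc (suc t * K)
  chain-length t [] _ _ _ _ = z≤n
  chain-length t (i ∷ xs) n<2ᵗ (i≺xs ∷ chain) (wide ∷ wides) (_ ∷ within) =
    s≤s (count t 1 0 xs ≤-refl 0<K (subst (n <_) (sym (*-identityʳ (2 ^ t))) n<2ᵗ)
           chain wides within (All.map (λ {j} → start≥1 {j}) i≺xs))
    where
    -- every later interval starts after the (positive) upper end of the first
    start≥1 : ∀ {j} → Precedes i j → Beyond 1 0 j
    start≥1 hi≤lo′ = *-monoʳ-≤ K (≤-trans (≤-trans (s≤s z≤n) (wide⇒lo<hi {K} {proj₁ i} wide)) hi≤lo′)

mirror : ℕ → Interval → Interval
mirror n (lo , hi) = (n ∸ hi , n ∸ lo)

mirror-precedes : ∀ n {i j} → Precedes i j → Precedes (mirror n j) (mirror n i)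
mirror-precedes n hi≤lo′ = ∸-monoʳ-≤ n hi≤lo′

mirror-within : ∀ n i → Within n (mirror n i)
mirror-within n (lo , _) = m∸n≤m n lo

mirror-length : ∀ {n lo hi} → lo ≤ hi → hi ≤ n → (n ∸ lo) ∸ (n ∸ hi) ≡ hi ∸ lo
mirror-length {n} {lo} {hi} lo≤hi hi≤n = begin
  (n ∸ lo) ∸ (n ∸ hi)                    ≡⟨ cong (_∸ (n ∸ hi)) n∸lo ⟩
  ((n ∸ hi) + (hi ∸ lo)) ∸ (n ∸ hi)      ≡⟨ m+n∸m≡n (n ∸ hi) (hi ∸ lo) ⟩
  hi ∸ lo                                ∎
  where
  open ≡-Reasoning
  n∸lo : n ∸ lo ≡ (n ∸ hi) + (hi ∸ lo)
  n∸lo = begin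
    n ∸ lo                  ≡⟨ cong (_∸ lo) (sym (m∸n+n≡m hi≤n)) ⟩
    ((n ∸ hi) + hi) ∸ lo    ≡⟨ +-∸-assoc (n ∸ hi) lo≤hi ⟩
    (n ∸ hi) + (hi ∸ lo)    ∎

mirror-sum : ∀ {n lo hi} → lo ≤ n → hi ≤ n → (n ∸ hi) + (n ∸ lo) ≡ 2 * n ∸ (lo + hi)
mirror-sum {n} {lo} {hi} lo≤n hi≤n = begin
  (n ∸ hi) + (n ∸ lo)       ≡⟨ sym (+-∸-assoc (n ∸ hi) lo≤n) ⟩
  ((n ∸ hi) + n) ∸ lo       ≡⟨ cong (_∸ lo) (sym (+-∸-comm n hi≤n)) ⟩
  ((n + n) ∸ hi) ∸ lo       ≡⟨ ∸-+-assoc (n + n) hi lo ⟩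
  (n + n) ∸ (hi + lo)       ≡⟨ cong₂ _∸_ (cong (n +_) (sym (+-identityʳ n))) (+-comm hi lo) ⟩
  2 * n ∸ (lo + hi)         ∎
  where open ≡-Reasoning

mirror-wide : ∀ {K n lo hi} → lo ≤ hi → hi ≤ n → 2 * n ∸ (lo + hi) < K * (hi ∸ lo) →
              Wide K (mirror n (lo , hi))
mirror-wide {K} lo≤hi hi≤n =
  subst₂ (λ s g → s < K * g) (sym (mirror-sum (≤-trans lo≤hi hi≤n) hi≤n)) (sym (mirror-length lo≤hi hi≤n))

All-reverse : ∀ {A : Set} {P : A → Set} {xs} → All P xs → All P (reverse xs)
All-reverse [] = []
All-reverse {xs = x ∷ xs} (px ∷ pxs) rewrite unfold-reverse x xs = All.++⁺ (All-reverse pxs) (px ∷ [])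

AllPairs-reverse : ∀ {A : Set} {R : A → A → Set} {xs} → AllPairs R xs → AllPairs (flip R) (reverse xs)
AllPairs-reverse [] = []
AllPairs-reverse {xs = x ∷ xs} (rx ∷ rxs) rewrite unfold-reverse x xs =
  AllPairs.++⁺ (AllPairs-reverse rxs) ([] ∷ []) (All.map (_∷ []) (All-reverse rx))

length-filter-∁ : ∀ {A : Set} {P : A → Set} (P? : Decidable P) xs →
                  length (filter P? xs) + length (filter (∁? P?) xs) ≡ length xs
length-filter-∁ P? [] = refl
length-filter-∁ P? (x ∷ xs) with does (P? x)
... | true  = cong suc (length-filter-∁ P? xs)
... | false = trans (+-suc _ _) (cong suc (length-filter-∁ P? xs))

-- a chain of intervals in [0, n], n < 2^t, each wide at 0 or at n, has at most
-- 2(1 + (t+1)K) members: the intervals wide at 0 form one chain, the reflections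
-- of the others, read from right to left, another
two-sided-count : ∀ K n t .{{_ : NonZero K}} xs → n < 2 ^ t → AllPairs Precedes xs → All (Within n) xs →
                  All (λ i → Wide K i ⊎ Wide K (mirror n i)) xs → length xs ≤ 2 * suc (suc t * K)
two-sided-count K n t xs n<2ᵗ chain within wide± = begin
  length xs                                   ≡⟨ sym (length-filter-∁ wide? xs) ⟩
  length nearZero + length nearN              ≤⟨ +-mono-≤ nearZero-count nearN-count ⟩
  suc (suc t * K) + suc (suc t * K)           ≡⟨ cong (suc (suc t * K) +_) (sym (+-identityʳ _)) ⟩
  2 * suc (suc t * K)                         ∎
  where
  open ≤-Reasoning
  open ChainCount K n using (chain-length)
  wide? : Decidable (Wide K)
  wide? (lo , hi) = lo + hi <? K * (hi ∸ lo)
  nearZero nearN reflected : List Interval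
  nearZero = filter wide? xs
  nearN = filter (∁? wide?) xs
  reflected = reverse (map (mirror n) nearN)
  nearZero-count : length nearZero ≤ suc (suc t * K)
  nearZero-count = chain-length t nearZero n<2ᵗ (AllPairs.filter⁺ wide? chain)
                     (All.all-filter wide? xs) (All.filter⁺ wide? within)
  reflected-wide : All (Wide K ∘ mirror n) nearN
  reflected-wide = All.zipWith (λ (w± , ¬w) → [ (λ w → ⊥-elim (¬w w)) , (λ w → w) ]′ w±)
                     (All.filter⁺ (∁? wide?) wide± , All.all-filter (∁? wide?) xs)
  reflected-chain : AllPairs Precedes reflected
  reflected-chain = AllPairs-reverse (AllPairs.map⁺ (AllPairs.map (λ {i} {j} → mirror-precedes n {i} {j})
                      (AllPairs.filter⁺ (∁? wide?) chain)))
  nearN-count : length nearN ≤ suc (suc t * K)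
  nearN-count = begin
    length nearN                      ≡⟨ sym (length-map (mirror n) nearN) ⟩
    length (map (mirror n) nearN)     ≡⟨ sym (length-reverse (map (mirror n) nearN)) ⟩
    length reflected                  ≤⟨ chain-length t reflected n<2ᵗ reflected-chain
                                           (All-reverse (All.map⁺ reflected-wide))
                                           (All-reverse (All.map⁺ (All.universal (mirror-within n) nearN))) ⟩
    suc (suc t * K)                   ∎

Defined : Maybe Bool → Set
Defined m = ∃ λ v → m ≡ just v

differ⇒defined : ∀ u v → T (differ u v) → Defined u × Defined v
differ⇒defined (just x) (just y) _ = (x , refl) , (y , refl)

allᵇ-elim : ∀ {A : Set} (p : A → Bool) xs {x} → T (allᵇ p xs) → x ∈ xs → T (p x)
allᵇ-elim p (y ∷ ys) t (here refl) = proj₁ (Equivalence.to T-∧ t)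
allᵇ-elim p (y ∷ ys) t (there x∈) = allᵇ-elim p ys (proj₂ (Equivalence.to T-∧ t)) x∈

inside⇒undefined : ∀ x y m → T x → T y → T (not (x ∧ y) ∨ not (isDefined m)) → ¬ Defined m
inside⇒undefined true true nothing _ _ _ (_ , ())

module JumpList {n : ℕ} (f : Vec Bool n → Vec Bool n → Bool) (a b : ℕ) where

  H : ℕ → Maybe Bool
  H = h f a b

  -- the part of the definition of a jump that the counting uses
  record IsJump (lo hi : ℕ) : Set where
    field
      lo<hi      : lo < hi
      lo-defined : Defined (H lo)
      hi-defined : Defined (H hi)
      gap        : ∀ {d} → lo < d → d < hi → ¬ Defined (H d)

  isJump-sound : ∀ lo hi → T (isJump f a b lo hi) → IsJump lo hi
  isJump-sound lo hi t = record
    { lo<hi      = <ᵇ⇒< lo hi (proj₁ t₁)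
    ; lo-defined = proj₁ (differ⇒defined (H lo) (H hi) (proj₁ t₂))
    ; hi-defined = proj₂ (differ⇒defined (H lo) (H hi) (proj₁ t₂))
    ; gap        = λ {d} lo<d d<hi → inside⇒undefined (lo <ᵇ d) (d <ᵇ hi) (H d) (<⇒<ᵇ lo<d) (<⇒<ᵇ d<hi)
                     (allᵇ-elim _ (upTo hi) (proj₂ t₂) (∈-upTo⁺ d<hi))
    }
    where
    t₁ : T (lo <ᵇ hi) × T (differ (H lo) (H hi) ∧ _)
    t₁ = Equivalence.to T-∧ t
    t₂ : T (differ (H lo) (H hi)) × T (allᵇ _ (upTo hi))
    t₂ = Equivalence.to T-∧ (proj₂ t₁)

  Listed : Interval → Set
  Listed (lo , hi) = IsJump lo hi × hi ≤ n

  jumpsFrom : ℕ → List Interval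
  jumpsFrom lo = map (lo ,_) (filterᵇ (isJump f a b lo) (upTo (suc n)))

  listed : ∀ {i} → i ∈ jumps f a b → Listed i
  listed i∈ with find (∈-concatMap⁻ jumpsFrom {xs = upTo (suc n)} i∈)
  ... | lo , _ , i∈from with ∈-map⁻ (lo ,_) i∈from
  ... | hi , hi∈ , refl with ∈-filter⁻ (T? ∘ isJump f a b lo) {xs = upTo (suc n)} hi∈
  ... | hi∈upTo , t = isJump-sound lo hi t , ≤-pred (∈-upTo⁻ hi∈upTo)

  all-listed : All Listed (jumps f a b)
  all-listed = All.tabulate listed

  Lex : Interval → Interval → Set
  Lex = ×-Lex _≡_ _<_ _<_

  jumps-lex-sorted : AllPairs Lex (jumps f a b)
  jumps-lex-sorted = AllPairs.concat⁺ (All.map⁺ (All.universal from-sorted (upTo (suc n))))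
                       (AllPairs.map⁺ (AllPairs.applyUpTo⁺₁ (λ lo → lo) (suc n) (λ lo<lo′ _ → across lo<lo′)))
    where
    from-sorted : ∀ lo → AllPairs Lex (jumpsFrom lo)
    from-sorted lo = AllPairs.map⁺ (AllPairs.filter⁺ (T? ∘ isJump f a b lo)
                       (AllPairs.applyUpTo⁺₁ (λ hi → hi) (suc n) (λ hi<hi′ _ → inj₂ (refl , hi<hi′))))
    across : ∀ {lo lo′} → lo < lo′ → All (λ i → All (Lex i) (jumpsFrom lo′)) (jumpsFrom lo)
    across lo<lo′ = All.map⁺ (All.universal (λ _ → All.map⁺ (All.universal (λ _ → inj₁ lo<lo′) _)) _)

  -- two distinct jumps are disjoint: an endpoint of one cannot lie in the gap of the other
  lex⇒precedes : ∀ {i j} → Listed i → Listed j → Lex i j → Precedes i j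
  lex⇒precedes {lo , hi} {lo′ , hi′} (J , _) (J′ , _) (inj₁ lo<lo′) with hi ≤? lo′
  ... | yes hi≤lo′ = hi≤lo′
  ... | no hi≰lo′ = ⊥-elim (IsJump.gap J lo<lo′ (≰⇒> hi≰lo′) (IsJump.lo-defined J′))
  lex⇒precedes {lo , hi} {lo′ , hi′} (J , _) (J′ , _) (inj₂ (refl , hi<hi′)) =
    ⊥-elim (IsJump.gap J′ (IsJump.lo<hi J) hi<hi′ (IsJump.hi-defined J))

  jumps-chain : AllPairs Precedes (jumps f a b)
  jumps-chain = refine all-listed jumps-lex-sorted
    where
    refine : ∀ {xs} → All Listed xs → AllPairs Lex xs → AllPairs Precedes xs
    refine [] [] = []
    refine (lx ∷ lxs) (rx ∷ rxs) = All.zipWith (λ (ly , r) → lex⇒precedes lx ly r) (lxs , rx) ∷ refine lxs rxs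

log₂-bound : ∀ q {M} → ⌊log₂ q ⌋ ≤ M → q < 2 ^ suc M
log₂-bound q {M} log≤M with q <? 2 ^ suc M
... | yes q<2ᴹ⁺¹ = q<2ᴹ⁺¹
... | no q≮2ᴹ⁺¹ = ⊥-elim (n≮n M (begin-strict
  M                      <⟨ n<1+n M ⟩
  suc M                  ≡⟨ sym (⌊log₂[2^n]⌋≡n (suc M)) ⟩
  ⌊log₂ (2 ^ suc M) ⌋    ≤⟨ ⌊log₂⌋-mono-≤ (≮⇒≥ q≮2ᴹ⁺¹) ⟩
  ⌊log₂ q ⌋              ≤⟨ log≤M ⟩
  M                      ∎))
  where open ≤-Reasoning

div-bound : ∀ m g o → 0 < g → m div g < o → m < o * g
div-bound m (suc g) o _ m/g<o with m <? o * suc g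
... | yes m<og = m<og
... | no m≮og = ⊥-elim (<⇒≱ m/g<o (begin
  o                    ≡⟨ sym (m*n/n≡m o (suc g)) ⟩
  o * suc g / suc g    ≤⟨ /-monoˡ-≤ (suc g) (≮⇒≥ m≮og) ⟩
  m / suc g            ∎))
  where open ≤-Reasoning

min-split : ∀ {m n o} → m ⊓ n < o → m < o ⊎ n < o
min-split {m} {n} m⊓n<o = [ (λ e → inj₁ (subst (_< _) e m⊓n<o)) , (λ e → inj₂ (subst (_< _) e m⊓n<o)) ]′ (⊓-sel m n)

-- a jump (lo , hi) of measure at most M is wide, for K = 2^(M+1), at 0 or at n:
-- its logarithmic term gives min(lo+hi, 2n−lo−hi) < K·(hi−lo)
measure⇒wide : ∀ n a b {M lo hi} → lo < hi → hi ≤ n → jumpMeasure n a b lo hi ≤ M →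
               Wide (2 ^ suc M) (lo , hi) ⊎ Wide (2 ^ suc M) (mirror n (lo , hi))
measure⇒wide n a b {M} {lo} {hi} lo<hi hi≤n μ≤M =
  map₂ (mirror-wide {2 ^ suc M} (<⇒≤ lo<hi) hi≤n)
    (min-split (div-bound s₂ (hi ∸ lo) (2 ^ suc M) (m<n⇒0<n∸m lo<hi)
      (log₂-bound (s₂ div (hi ∸ lo)) (≤-trans (m≤n⊔m _ _) μ≤M))))
  where
  s₂ : ℕ
  s₂ = (lo + hi) ⊓ (2 * n ∸ (lo + hi))

maxList-≥ : ∀ {x xs} → x ∈ xs → x ≤ maxList xs
maxList-≥ {x} {_ ∷ xs} (here refl) = m≤m⊔n x (maxList xs)
maxList-≥ {x} {y ∷ _} (there x∈) = ≤-trans (maxList-≥ x∈) (m≤n⊔m y _)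

measure≤mNat : ∀ {n} (f : Vec Bool n → Vec Bool n → Bool) {a b lo hi} → 1 ≤ a → a ≤ n → 1 ≤ b → b ≤ n →
               (lo , hi) ∈ jumps f a b → jumpMeasure n a b lo hi ≤ mNat f
measure≤mNat f {suc a} {suc b} _ 1+a≤n _ 1+b≤n i∈ =
  maxList-≥ (∈-concatMap⁺ _ (lose (∈-map⁺ suc (∈-upTo⁺ 1+a≤n))
    (∈-concatMap⁺ _ (lose (∈-map⁺ suc (∈-upTo⁺ 1+b≤n)) (∈-map⁺ _ i∈)))))

-- The degenerate cases a = 0, b = 0 and n = 1, which m(f) does not see:
-- there h_{a,b} is defined at one distance only, so it has no jumps.

head-∈ : ∀ {A : Set} (xs : List A) {v} → head xs ≡ just v → v ∈ xs
head-∈ (x ∷ xs) refl = here refl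

h-witness : ∀ {n} (f : Vec Bool n → Vec Bool n → Bool) a b d → Defined (h f a b d) →
            ∃ λ x → ∃ λ y → weight x ≡ a × weight y ≡ b × dist x y ≡ d
h-witness {n} f a b d (_ , hd≡v) with find (∈-concatMap⁻ _ {xs = allVecs n} (head-∈ _ hd≡v))
... | x , _ , v∈ with ∈-map⁻ (f x) v∈
... | y , y∈ , _ = x , y , ≡ᵇ⇒≡ _ _ (proj₁ t₁) , ≡ᵇ⇒≡ _ _ (proj₁ t₂) , ≡ᵇ⇒≡ _ _ (proj₂ t₂)
  where
  matches : Vec Bool n → Bool
  matches y = (weight x ≡ᵇ a) ∧ (weight y ≡ᵇ b) ∧ (dist x y ≡ᵇ d)
  t₁ : T (weight x ≡ᵇ a) × T ((weight y ≡ᵇ b) ∧ (dist x y ≡ᵇ d))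
  t₁ = Equivalence.to T-∧ (proj₂ (∈-filter⁻ (T? ∘ matches) {xs = allVecs n} y∈))
  t₂ : T (weight y ≡ᵇ b) × T (dist x y ≡ᵇ d)
  t₂ = Equivalence.to T-∧ (proj₂ t₁)

no-jumps : ∀ {n} (f : Vec Bool n → Vec Bool n → Bool) a b D →
           (∀ d → Defined (h f a b d) → d ≡ D) → numJumps f a b ≡ 0
no-jumps f a b D only-D with jumps f a b | JumpList.all-listed f a b
... | []            | _           = refl
... | (lo , hi) ∷ _ | (J , _) ∷ _ =
  ⊥-elim (<-irrefl (trans (only-D lo (lo-defined J)) (sym (only-D hi (hi-defined J)))) (lo<hi J))
  where open JumpList.IsJump

dist-weight0ˡ : ∀ {n} (x y : Vec Bool n) → weight x ≡ 0 → dist x y ≡ weight y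
dist-weight0ˡ [] [] _ = refl
dist-weight0ˡ (false ∷ x) (c ∷ y) w≡0 = cong ((if c then 1 else 0) +_) (dist-weight0ˡ x y w≡0)

dist-weight0ʳ : ∀ {n} (x y : Vec Bool n) → weight y ≡ 0 → dist x y ≡ weight x
dist-weight0ʳ [] [] _ = refl
dist-weight0ʳ (c ∷ x) (false ∷ y) w≡0 = cong₂ _+_ (cong (λ c′ → if c′ then 1 else 0) (xor-identityʳ c)) (dist-weight0ʳ x y w≡0)

dist-length1 : (x y : Vec Bool 1) → weight x ≡ 1 → weight y ≡ 1 → dist x y ≡ 0
dist-length1 (true ∷ []) (true ∷ []) _ _ = refl

no-jumps-a≡0 : ∀ {n} (f : Vec Bool n → Vec Bool n → Bool) b → numJumps f 0 b ≡ 0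
no-jumps-a≡0 f b = no-jumps f 0 b b λ d def →
  let (x , y , wx , wy , dxy) = h-witness f 0 b d def in trans (sym dxy) (trans (dist-weight0ˡ x y wx) wy)

no-jumps-b≡0 : ∀ {n} (f : Vec Bool n → Vec Bool n → Bool) a → numJumps f a 0 ≡ 0
no-jumps-b≡0 f a = no-jumps f a 0 a λ d def →
  let (x , y , wx , wy , dxy) = h-witness f a 0 d def in trans (sym dxy) (trans (dist-weight0ʳ x y wy) wx)

no-jumps-n≡1 : (f : Vec Bool 1 → Vec Bool 1 → Bool) → numJumps f 1 1 ≡ 0
no-jumps-n≡1 f = no-jumps f 1 1 0 λ d def →
  let (x , y , wx , wy , dxy) = h-witness f 1 1 d def in trans (sym dxy) (dist-length1 x y wx wy)

-- The main estimate for a, b ∈ [n]: every jump is wide at 0 or at n with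
-- K = 2^(m+1), and the jumps form a chain in [0, n] where n < 2^(⌊log₂ n⌋+1).
jumps-bound : ∀ {n} (f : Vec Bool n → Vec Bool n → Bool) {a b} → 1 ≤ a → a ≤ n → 1 ≤ b → b ≤ n →
              numJumps f a b ≤ 2 * suc (suc (suc ⌊log₂ n ⌋) * 2 ^ suc (mNat f))
jumps-bound {n} f {a} {b} 1≤a a≤n 1≤b b≤n =
  two-sided-count (2 ^ suc M) n (suc ⌊log₂ n ⌋) {{m^n≢0 2 (suc M)}} (jumps f a b)
    (log₂-bound n ≤-refl) jumps-chain (All.map proj₂ all-listed) (All.tabulate wide±)
  where
  open JumpList f a b
  M : ℕ
  M = mNat f
  wide± : ∀ {i} → i ∈ jumps f a b → Wide (2 ^ suc M) i ⊎ Wide (2 ^ suc M) (mirror n i)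
  wide± i∈ with listed i∈
  ... | J , hi≤n = measure⇒wide n a b (IsJump.lo<hi J) hi≤n (measure≤mNat f 1≤a a≤n 1≤b b≤n i∈)

final-arith : ∀ L P → 1 ≤ L → 1 ≤ P → 2 * suc (suc (suc L) * (2 * P)) ≤ 14 * P * L
final-arith (suc l) (suc p) _ _ =
  subst (lhs ≤_) (expand l p) (m≤m+n lhs (2 * p + 10 * l + 10 * l * p))
  where
  lhs : ℕ
  lhs = 2 * suc (suc (suc (suc l)) * (2 * suc p))
  expand : ∀ l p → 2 * suc (suc (suc (suc l)) * (2 * suc p)) + (2 * p + 10 * l + 10 * l * p)
                   ≡ 14 * suc p * suc l
  expand = solve-∀

lemma3p6 : Σ ℕ λ A → Σ ℕ λ B →
    (n : ℕ) (f : Vec Bool n → Vec Bool n → Bool) → PermInvariant f →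
    (a b : ℕ) → a ≤ n → b ≤ n →
    numJumps f a b ≤ A * 2 ^ (B * mNat f) * ⌊log₂ n ⌋
lemma3p6 = 14 , 1 , λ n f _ → bound n f
  where
  bound : ∀ n (f : Vec Bool n → Vec Bool n → Bool) a b → a ≤ n → b ≤ n →
          numJumps f a b ≤ 14 * 2 ^ (1 * mNat f) * ⌊log₂ n ⌋
  bound n f zero b _ _ = ≤-trans (≤-reflexive (no-jumps-a≡0 f b)) z≤n
  bound n f (suc a) zero _ _ = ≤-trans (≤-reflexive (no-jumps-b≡0 f (suc a))) z≤n
  bound 1 f 1 1 _ _ = ≤-trans (≤-reflexive (no-jumps-n≡1 f)) z≤n
  bound 1 f (2+ _) _ (s≤s ()) _
  bound 1 f 1 (2+ _) _ (s≤s ())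
  bound n@(2+ _) f a@(suc _) b@(suc _) a≤n b≤n = begin
    numJumps f a b                                  ≤⟨ jumps-bound f (s≤s z≤n) a≤n (s≤s z≤n) b≤n ⟩
    2 * suc (suc (suc L) * (2 * 2 ^ M))             ≤⟨ final-arith L (2 ^ M) (⌊log₂⌋-mono-≤ {2} {n} (s≤s (s≤s z≤n))) (m^n>0 2 M) ⟩
    14 * 2 ^ M * L                                  ≡⟨ cong (λ e → 14 * 2 ^ e * L) (sym (*-identityˡ M)) ⟩
    14 * 2 ^ (1 * M) * L                            ∎
    where
    open ≤-Reasoning
    M L : ℕ
    M = mNat f
    L = ⌊log₂ n ⌋
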